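{- Let $G$ be a DAG. Then $G$ has the global pairwise-lca-property if and only if $G$ has the global lca-property.
   Context: A DAG is a finite directed graph without loops and without directed cycles. For a DAG $G$ and $u,v\in V(G)$, write $u\preceq_G v$ if there is a directed path from $v$ to $u$ (in particular $v\preceq_G v$); then $v$ is an ancestor of $u$. For a non-empty $A\subseteq V(G)$, a common ancestor of $A$ is a vertex $v$ with $a\preceq_G v$ for all $a\in A$; $\mathrm{LCA}_G(A)$ denotes the set of $\preceq_G$-minimal common ancestors of $A$. $G$ has the global lca-property if $|\mathrm{LCA}_G(A)|=1$ for every non-empty $A\subseteq V(G)$, and the global pairwise-lca-property if $|\mathrm{LCA}_G(A)|=1$ for every $A\subseteq V(G)$ with $|A|=2$. -}

module Defs where

open import Data.Nat using (ℕ)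
open import Data.Fin using (Fin)
open import Data.Fin.Subset using (Subset; _∈_; Nonempty; ∣_∣)
open import Data.Bool using (Bool; T)
open import Data.Product using (Σ; ∃; _×_; _,_)
open import Relation.Binary.PropositionalEquality using (_≡_)
open import Relation.Binary.Construct.Closure.ReflexiveTransitive using (Star)
open import Relation.Binary.Construct.Closure.Transitive using (TransClosure)
open import Relation.Nullary using (¬_)

record Digraph : Set where
  field
    n   : ℕ
    adj : Fin n → Fin n → Bool
open Digraph public

Arc : (G : Digraph) → Fin (n G) → Fin (n G) → Set
Arc G u v = T (adj G u v)

IsDAG : Digraph → Set
IsDAG G = (∀ v → ¬ Arc G v v) × (∀ v → ¬ TransClosure (Arc G) v v)

-- u ⪯_G v  iff there is a directed path (possibly trivial) from v to u.
-- (written Below G u v)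

Below : (G : Digraph) → Fin (n G) → Fin (n G) → Set
Below G u v = Star (Arc G) v u

CommonAncestor : (G : Digraph) → Subset (n G) → Fin (n G) → Set
CommonAncestor G A v = ∀ a → a ∈ A → Below G a v

IsLCA : (G : Digraph) → Subset (n G) → Fin (n G) → Set
IsLCA G A v = CommonAncestor G A v
            × (∀ w → CommonAncestor G A w → Below G w v → w ≡ v)

UniqueLCA : (G : Digraph) → Subset (n G) → Set
UniqueLCA G A = Σ (Fin (n G)) λ v → IsLCA G A v × (∀ w → IsLCA G A w → w ≡ v)

GlobalLCAProperty : Digraph → Set
GlobalLCAProperty G = ∀ (A : Subset (n G)) → Nonempty A → UniqueLCA G A

GlobalPairwiseLCAProperty : Digraph → Set
GlobalPairwiseLCAProperty G = ∀ (A : Subset (n G)) → ∣ A ∣ ≡ 2 → UniqueLCA G A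

{-# OPTIONS --safe #-}
module Submission where

open import Defs
open import Data.Bool.Properties using (T?)
open import Data.Fin using (Fin; zero; suc)
open import Data.Fin.Induction using (spo-noetherian)
open import Data.Fin.Properties using (_≟_; any?; all?)
open import Data.Fin.Subset using (Subset; _∈_; Nonempty; ∣_∣; ⁅_⁆; _∪_)
open import Data.Fin.Subset.Properties
  using (_∈?_; nonempty?; Empty-unique; ∣⊥∣≡0; ∣⁅x⁆∣≡1; ∪-identityˡ; ∪-identityʳ;
         x∈⁅x⁆; x∈⁅y⁆⇒x≡y; x∈p∪q⁺; x∈p∪q⁻)
open import Data.List using (List; []; _∷_; filter; allFin)
open import Data.List.Relation.Unary.All as All using (All; []; _∷_)
open import Data.List.Relation.Unary.Any using (there)
open import Data.List.Membership.Propositional.Properties using (∈-filter⁺; ∈-filter⁻; ∈-allFin)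
open import Data.Nat using (suc)
open import Data.Nat.Properties using (1+n≢0)
open import Data.Product using (Σ; ∃-syntax; _×_; _,_; proj₁; proj₂)
open import Data.Sum using (inj₁; inj₂; [_,_]′)
open import Function using (_∘_; flip)
open import Function.Bundles using (_⇔_; mk⇔; module Equivalence)
open import Induction.WellFounded using (WellFounded; Acc; acc; module Subrelation)
open import Level using (Level)
open import Relation.Binary using (Rel; Decidable; Antisymmetric; IsPartialOrder)
open import Relation.Binary.Lattice using (IsJoinSemilattice)
open import Relation.Binary.PropositionalEquality
  using (_≡_; _≢_; refl; sym; trans; cong; subst; isEquivalence; resp₂)
open import Relation.Binary.Construct.Closure.ReflexiveTransitive using (Star; ε; _◅_; _◅◅_)
open import Relation.Binary.Construct.Closure.Transitive using (TransClosure; [_]; _∷_; _++_)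
open import Relation.Nullary using (¬_; Dec; yes; no; contradiction)
open import Relation.Nullary.Decidable using (map′; decidable-stable; _×-dec_; _→-dec_; ¬?)
open import Relation.Unary as U using (Pred)

-- The ancestor order ⪯ of a DAG is a partial order on a finite set, so every
-- common ancestor of A lies above some ⪯-minimal one; hence a unique minimal
-- common ancestor is in fact the least common ancestor. The pairwise-lca
-- property therefore makes ⪯ a join-semilattice, and the join of the elements
-- of a nonempty A is the least, hence the only minimal, common ancestor of A.
-- The converse is the special case |A| = 2.

private
  variable
    a ℓ : Level

module _ {A : Set a} {R : Rel A ℓ} where

  _◅⁺_ : ∀ {x y z} → R x y → Star R y z → TransClosure R x z
  r ◅⁺ ε       = [ r ]
  r ◅⁺ (s ◅ p) = r ∷ (s ◅⁺ p)

  Star⇒TransClosure : ∀ {x y} → Star R x y → x ≢ y → TransClosure R x y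
  Star⇒TransClosure ε       x≢x = contradiction refl x≢x
  Star⇒TransClosure (r ◅ p) _   = r ◅⁺ p

  Star-antisym : (∀ x → ¬ TransClosure R x x) → Antisymmetric _≡_ (Star R)
  Star-antisym acyclic ε       _ = refl
  Star-antisym acyclic (r ◅ p) q = contradiction (r ◅⁺ (p ◅◅ q)) (acyclic _)

Star? : ∀ {n} {R : Rel (Fin n) ℓ} → Decidable R → WellFounded (flip R) → Decidable (Star R)
Star? {R = R} R? wf x y = reach (wf x)
  where
  reach : ∀ {x} → Acc (flip R) x → Dec (Star R x y)
  reach {x} (acc rs) with x ≟ y
  ... | yes refl = yes ε
  ... | no x≢y   = map′ (λ (_ , r , p) → r ◅ p) first-step (any? step)
    where
    step : ∀ z → Dec (R x z × Star R z y)
    step z with R? x z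
    ... | yes r = map′ (r ,_) proj₂ (reach (rs r))
    ... | no ¬r = no (¬r ∘ proj₁)

    first-step : Star R x y → ∃[ z ] R x z × Star R z y
    first-step ε       = contradiction refl x≢y
    first-step (r ◅ p) = _ , r , p

module JoinSemilatticeProperties
  {A : Set a} {_≈_ _≤_ : Rel A ℓ} {_∨_ : A → A → A}
  (isJoinSemilattice : IsJoinSemilattice _≈_ _≤_ _∨_) where

  open IsJoinSemilattice isJoinSemilattice using (x≤x∨y; y≤x∨y; ∨-least)
    renaming (refl to ≤-refl; trans to ≤-trans)

  ⋁ : A → List A → A
  ⋁ x []       = x
  ⋁ x (y ∷ ys) = x ∨ ⋁ y ys

  ⋁-upperBound : ∀ x xs → All (_≤ ⋁ x xs) (x ∷ xs)
  ⋁-upperBound x []       = ≤-refl ∷ []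
  ⋁-upperBound x (y ∷ ys) =
    x≤x∨y x _ ∷ All.map (λ a≤⋁ → ≤-trans a≤⋁ (y≤x∨y x _)) (⋁-upperBound y ys)

  ⋁-least : ∀ {z} x xs → All (_≤ z) (x ∷ xs) → ⋁ x xs ≤ z
  ⋁-least x []       (x≤z ∷ []) = x≤z
  ⋁-least x (y ∷ ys) (x≤z ∷ ys≤z) = ∨-least x≤z (⋁-least y ys ys≤z)

∣p∣≢0⇒Nonempty : ∀ {n} {p : Subset n} → ∣ p ∣ ≢ 0 → Nonempty p
∣p∣≢0⇒Nonempty {n} {p} ∣p∣≢0 =
  decidable-stable (nonempty? p) (λ ¬ne → ∣p∣≢0 (trans (cong ∣_∣ (Empty-unique ¬ne)) (∣⊥∣≡0 n)))

∣⁅x⁆∪⁅y⁆∣≡2 : ∀ {n} {x y : Fin n} → x ≢ y → ∣ ⁅ x ⁆ ∪ ⁅ y ⁆ ∣ ≡ 2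
∣⁅x⁆∪⁅y⁆∣≡2 {x = zero}  {zero}  x≢y = contradiction refl x≢y
∣⁅x⁆∪⁅y⁆∣≡2 {x = zero}  {suc y} _   = cong suc (trans (cong ∣_∣ (∪-identityˡ ⁅ y ⁆)) (∣⁅x⁆∣≡1 y))
∣⁅x⁆∪⁅y⁆∣≡2 {x = suc x} {zero}  _   = cong suc (trans (cong ∣_∣ (∪-identityʳ ⁅ x ⁆)) (∣⁅x⁆∣≡1 x))
∣⁅x⁆∪⁅y⁆∣≡2 {x = suc x} {suc y} x≢y = ∣⁅x⁆∪⁅y⁆∣≡2 (x≢y ∘ cong suc)

module _ (G : Digraph) where

  private
    V : Set
    V = Fin (n G)

    _⪯_ : V → V → Set
    _⪯_ = Below G

  Minimal : Pred V ℓ → V → Set ℓ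
  Minimal Q v = ∀ w → Q w → w ⪯ v → w ≡ v

  commonAncestor-pair : ∀ {x y w} → CommonAncestor G (⁅ x ⁆ ∪ ⁅ y ⁆) w ⇔ (x ⪯ w × y ⪯ w)
  commonAncestor-pair {x} {y} {w} = mk⇔
    (λ ca → ca x (x∈p∪q⁺ (inj₁ (x∈⁅x⁆ x))) , ca y (x∈p∪q⁺ {p = ⁅ x ⁆} (inj₂ (x∈⁅x⁆ y))))
    (λ (x⪯w , y⪯w) a a∈ → [ (λ a∈x → subst (_⪯ w) (sym (x∈⁅y⁆⇒x≡y x a∈x)) x⪯w)
                          , (λ a∈y → subst (_⪯ w) (sym (x∈⁅y⁆⇒x≡y y a∈y)) y⪯w)
                          ]′ (x∈p∪q⁻ ⁅ x ⁆ ⁅ y ⁆ a∈))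

  module _ (dag : IsDAG G) where

    properDescendant-wellFounded : WellFounded (flip (TransClosure (Arc G)))
    properDescendant-wellFounded = spo-noetherian record
      { isEquivalence = isEquivalence
      ; irrefl        = λ { refl → proj₂ dag _ }
      ; trans         = _++_
      ; <-resp-≈      = resp₂ _
      }

    below? : Decidable _⪯_
    below? u v = Star? (λ x y → T? (adj G x y))
                       (Subrelation.wellFounded [_] properDescendant-wellFounded) v u

    below-isPartialOrder : IsPartialOrder _≡_ _⪯_
    below-isPartialOrder = record
      { isPreorder = record
        { isEquivalence = isEquivalence
        ; reflexive     = λ { refl → ε }
        ; trans         = flip _◅◅_
        }
      ; antisym = λ u⪯v v⪯u → Star-antisym (proj₂ dag) v⪯u u⪯v
      }

    commonAncestor? : (A : Subset (n G)) → U.Decidable (CommonAncestor G A)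
    commonAncestor? A v = all? (λ a → (a ∈? A) →-dec below? a v)

    minimal-below : {Q : Pred V ℓ} → U.Decidable Q →
                    ∀ {w} → Q w → ∃[ m ] Q m × m ⪯ w × Minimal Q m
    minimal-below {Q = Q} Q? {w} qw = descend (properDescendant-wellFounded w) qw
      where
      descend : ∀ {w} → Acc (flip (TransClosure (Arc G))) w →
                Q w → ∃[ m ] Q m × m ⪯ w × Minimal Q m
      descend {w} (acc rs) qw with any? (λ m → Q? m ×-dec below? m w ×-dec ¬? (m ≟ w))
      ... | yes (m , qm , m⪯w , m≢w) =
        let (k , qk , k⪯m , k-minimal) = descend (rs (Star⇒TransClosure m⪯w (m≢w ∘ sym))) qm
        in k , qk , m⪯w ◅◅ k⪯m , k-minimal
      ... | no ∄m = w , qw , ε , λ m qm m⪯w →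
        decidable-stable (m ≟ w) (λ m≢w → ∄m (m , qm , m⪯w , m≢w))

    UniqueLCA⇒least : ∀ {A} (lca : UniqueLCA G A) {w} → CommonAncestor G A w → proj₁ lca ⪯ w
    UniqueLCA⇒least {A} (_ , _ , unique) caw =
      let (m , cam , m⪯w , m-minimal) = minimal-below (commonAncestor? A) caw
      in subst (_⪯ _) (unique m (cam , m-minimal)) m⪯w

    least⇒UniqueLCA : ∀ {A c} → CommonAncestor G A c → (∀ w → CommonAncestor G A w → c ⪯ w) →
                      UniqueLCA G A
    least⇒UniqueLCA {c = c} cac least =
        c
      , (cac , λ w caw w⪯c → IsPartialOrder.antisym below-isPartialOrder w⪯c (least w caw))
      , λ w (caw , w-minimal) → sym (w-minimal c cac (least w caw))

    module _ (pairwise : GlobalPairwiseLCAProperty G) where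

      pairwise⇒join : ∀ x y → Σ V λ d → x ⪯ d × y ⪯ d × (∀ z → x ⪯ z → y ⪯ z → d ⪯ z)
      pairwise⇒join x y with x ≟ y
      -- ⁅ x ⁆ ∪ ⁅ x ⁆ is a singleton, on which the pairwise property says nothing.
      ... | yes refl = x , ε , ε , λ _ x⪯z _ → x⪯z
      ... | no x≢y   =
        let lca         = pairwise (⁅ x ⁆ ∪ ⁅ y ⁆) (∣⁅x⁆∪⁅y⁆∣≡2 x≢y)
            (x⪯d , y⪯d) = Equivalence.to commonAncestor-pair (proj₁ (proj₁ (proj₂ lca)))
        in proj₁ lca , x⪯d , y⪯d ,
           λ z x⪯z y⪯z → UniqueLCA⇒least lca (Equivalence.from commonAncestor-pair (x⪯z , y⪯z))

      _∨_ : V → V → V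
      x ∨ y = proj₁ (pairwise⇒join x y)

      below-isJoinSemilattice : IsJoinSemilattice _≡_ _⪯_ _∨_
      below-isJoinSemilattice = record
        { isPartialOrder = below-isPartialOrder
        ; supremum       = λ x y → proj₂ (pairwise⇒join x y)
        }

      pairwise⇒global : GlobalLCAProperty G
      pairwise⇒global A (x , x∈A) = least⇒UniqueLCA ca least
        where
        open JoinSemilatticeProperties below-isJoinSemilattice

        xs : List V
        xs = filter (_∈? A) (allFin _)

        ca : CommonAncestor G A (⋁ x xs)
        ca a a∈A = All.lookup (⋁-upperBound x xs) (there (∈-filter⁺ (_∈? A) (∈-allFin a) a∈A))

        least : ∀ w → CommonAncestor G A w → ⋁ x xs ⪯ w
        least w caw = ⋁-least x xs (caw x x∈A ∷ All.tabulate λ a∈xs →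
          caw _ (proj₂ (∈-filter⁻ (_∈? A) {xs = allFin _} a∈xs)))

theorem3p6 : (G : Digraph) → IsDAG G → (GlobalPairwiseLCAProperty G ⇔ GlobalLCAProperty G)
theorem3p6 G dag = mk⇔ (pairwise⇒global G dag) global⇒pairwise
  where
  global⇒pairwise : GlobalLCAProperty G → GlobalPairwiseLCAProperty G
  global⇒pairwise global A ∣A∣≡2 = global A (∣p∣≢0⇒Nonempty (1+n≢0 ∘ trans (sym ∣A∣≡2)))
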